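{- There is a compact poset $\mathfrak F$ such that the quotients $\mathfrak F/{\sim_n}$, $n<\omega$, are pairwise distinct.
   Context: A poset is compact if every element lies below some maximal element. For $x$ in a compact poset, $M(x)$ is the set of maximal elements above $x$; $x\sim_0 y$ iff $M(x)=M(y)$; $x\sim_{n+1}y$ iff $\{[z]_n:z\ge x\}=\{[z]_n:z\ge y\}$, where $[z]_n$ is the $\sim_n$-class of $z$. $\mathfrak F/{\sim_n}$ is the quotient by the equivalence relation $\sim_n$. -}

module Defs where

open import Level using (0ℓ)
open import Data.Nat using (ℕ; zero; suc)
open import Data.Product using (Σ; _×_; ∃; ∃-syntax)
open import Relation.Binary.Bundles using (Poset)

module PosetNotions (P : Poset 0ℓ 0ℓ 0ℓ) where
  open Poset P

  Maximal : Carrier → Set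
  Maximal x = ∀ y → x ≤ y → x ≈ y

  Compact : Set
  Compact = ∀ x → ∃[ m ] (Maximal m × x ≤ m)

  -- x ∼ₙ y
  --   ∼₀ : M(x) = M(y), i.e. x and y lie below the same maximal elements
  --   ∼ₙ₊₁ : {[z]ₙ : z ≥ x} = {[z]ₙ : z ≥ y}
  Sim : ℕ → Carrier → Carrier → Set
  Sim zero x y = ∀ m → Maximal m → (x ≤ m → y ≤ m) × (y ≤ m → x ≤ m)
  Sim (suc n) x y =
    (∀ z → x ≤ z → ∃[ w ] (y ≤ w × Sim n z w)) ×
    (∀ w → y ≤ w → ∃[ z ] (x ≤ z × Sim n z w))

  SameQuotient : ℕ → ℕ → Set
  SameQuotient m n = ∀ x y → (Sim m x y → Sim n x y) × (Sim n x y → Sim m x y)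

{-# OPTIONS --safe #-}
module Submission where

-- The poset 𝔉 is built from maximal points top i, a point Z below top 0 and
-- top 1, and two sequences X n, Y n whose maximal points are exactly top 0, …,
-- top (2 + n).  X (1 + n) is covered by X n, Y n and top (3 + n); Y (1 + n)
-- only by X n and top (3 + n).  So X n ∼ₙ Y n by induction: a point above
-- X (1 + n) is either also above Y (1 + n), or it is Y n, which is matched by
-- X n since X n ∼ₙ Y n.  Conversely X (1 + n) ≁ₙ₊₂ Y (1 + n): the point Y n
-- above X (1 + n) would need a partner w above Y (1 + n) with w ∼ₙ₊₁ Y n, but
-- the only point there with the same maximal points as Y n is X n, and
-- X n ≁ₙ₊₁ Y n by induction.  At the bottom, Z separates X 0 from Y 0.

open import Defs
open import Level using (0ℓ)
open import Data.Nat using (ℕ; zero; suc; _+_; _≤_; _<_; _≤′_; ≤′-refl; ≤′-step; z≤n; s≤s)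
open import Data.Nat.Properties using (≤⇒≤′; <-cmp; <-irrefl; ≤-refl; m≤n⇒m≤1+n; m≤n⇒m<n∨m≡n)
open import Data.Product using (Σ; _×_; _,_; proj₁; proj₂; swap; ∃-syntax; ∃₂)
open import Data.Sum using (_⊎_; inj₁; inj₂)
open import Data.Empty using (⊥-elim)
open import Function using (_∘_)
open import Relation.Binary.Bundles using (Preorder; Poset; Setoid)
open import Relation.Binary.Construct.Closure.ReflexiveTransitive using (Star; ε; _◅_; _◅◅_)
open import Relation.Binary.Definitions using (tri<; tri≈; tri>)
open import Relation.Binary.PropositionalEquality using (_≡_; _≢_; refl)
open import Relation.Nullary using (¬_)
import Relation.Binary.Construct.Closure.ReflexiveTransitive.Properties as Star
import Relation.Binary.Properties.Preorder as PreorderProperties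

inducedPoset : ∀ {a ℓ₁ ℓ₂} → Preorder a ℓ₁ ℓ₂ → Poset a ℓ₂ ℓ₂
inducedPoset P = record
  { Carrier = Carrier
  ; _≈_ = Setoid._≈_ InducedEquivalence
  ; _≤_ = _≲_
  ; isPartialOrder = record
    { isPreorder = record
      { isEquivalence = Setoid.isEquivalence InducedEquivalence
      ; reflexive = proj₁
      ; trans = trans
      }
    ; antisym = _,_
    }
  }
  where
  open Preorder P
  open PreorderProperties P

module SimProperties (P : Poset 0ℓ 0ℓ 0ℓ) where
  open Poset P using (Carrier)
  module P = Poset P
  open PosetNotions P

  Sim-refl : ∀ n x → Sim n x x
  Sim-refl zero x m _ = (λ x≤m → x≤m) , (λ x≤m → x≤m)
  Sim-refl (suc n) x = (λ z x≤z → z , x≤z , Sim-refl n z) , (λ w x≤w → w , x≤w , Sim-refl n w)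

  Sim-sym : ∀ n {x y} → Sim n x y → Sim n y x
  Sim-sym zero sim m max = swap (sim m max)
  Sim-sym (suc n) (forth , back) =
    (λ z y≤z → let (w , x≤w , sim) = back z y≤z in w , x≤w , Sim-sym n sim) ,
    (λ w x≤w → let (z , y≤z , sim) = forth w x≤w in z , y≤z , Sim-sym n sim)

  Sim-suc⇒Sim : ∀ n {x y} → Sim (suc n) x y → Sim n x y
  Sim-suc⇒Sim zero (forth , back) m max =
    (λ x≤m → let (w , y≤w , sim) = forth m x≤m in P.trans y≤w (proj₁ (sim m max) P.refl)) ,
    (λ y≤m → let (z , x≤z , sim) = back m y≤m in P.trans x≤z (proj₂ (sim m max) P.refl))
  Sim-suc⇒Sim (suc n) (forth , back) =
    (λ z x≤z → let (w , y≤w , sim) = forth z x≤z in w , y≤w , Sim-suc⇒Sim n sim) ,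
    (λ w y≤w → let (z , x≤z , sim) = back w y≤w in z , x≤z , Sim-suc⇒Sim n sim)

  Sim-antitone : ∀ {m n x y} → m ≤ n → Sim n x y → Sim m x y
  Sim-antitone m≤n = go (≤⇒≤′ m≤n)
    where
    go : ∀ {m n x y} → m ≤′ n → Sim n x y → Sim m x y
    go ≤′-refl sim = sim
    go (≤′-step m≤′n) sim = go m≤′n (Sim-suc⇒Sim _ sim)

  SameQuotient-sym : ∀ {m n} → SameQuotient m n → SameQuotient n m
  SameQuotient-sym same x y = swap (same x y)

  Separated : ℕ → Set
  Separated n = ∃₂ λ x y → Sim n x y × ¬ Sim (suc n) x y

  separated⇒¬SameQuotient : ∀ {m n} → Separated m → m < n → ¬ SameQuotient m n
  separated⇒¬SameQuotient (x , y , sim , ¬sim) m<n same = ¬sim (Sim-antitone m<n (proj₁ (same x y) sim))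

  separated⇒distinct : (∀ n → Separated n) → ∀ m n → m ≢ n → ¬ SameQuotient m n
  separated⇒distinct sep m n m≢n same with <-cmp m n
  ... | tri< m<n _ _ = separated⇒¬SameQuotient (sep m) m<n same
  ... | tri≈ _ m≡n _ = m≢n m≡n
  ... | tri> _ _ n<m = separated⇒¬SameQuotient (sep n) n<m (SameQuotient-sym same)

data Point : Set where
  top : ℕ → Point
  Z : Point
  X Y : ℕ → Point

infix 4 _⋖_ _≼_

data _⋖_ : Point → Point → Set where
  Z⋖top₀ : Z ⋖ top 0
  Z⋖top₁ : Z ⋖ top 1
  X₀⋖Z : X 0 ⋖ Z
  X₀⋖top₂ : X 0 ⋖ top 2
  Y₀⋖top₀ : Y 0 ⋖ top 0
  Y₀⋖top₁ : Y 0 ⋖ top 1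
  Y₀⋖top₂ : Y 0 ⋖ top 2
  X⋖top : ∀ {n} → X (suc n) ⋖ top (3 + n)
  X⋖X : ∀ {n} → X (suc n) ⋖ X n
  X⋖Y : ∀ {n} → X (suc n) ⋖ Y n
  Y⋖top : ∀ {n} → Y (suc n) ⋖ top (3 + n)
  Y⋖X : ∀ {n} → Y (suc n) ⋖ X n

_≼_ : Point → Point → Set
_≼_ = Star _⋖_

𝔉 : Poset 0ℓ 0ℓ 0ℓ
𝔉 = inducedPoset (Star.preorder _⋖_)

open PosetNotions 𝔉
open SimProperties 𝔉

top-≼ : ∀ {i w} → top i ≼ w → w ≡ top i
top-≼ ε = refl

top-maximal : ∀ i → Maximal (top i)
top-maximal i _ ε = ε , ε

¬top≼top : ∀ {i j} → i ≢ j → ¬ top i ≼ top j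
¬top≼top i≢j ε = i≢j refl

¬Z≼top₂ : ¬ Z ≼ top 2
¬Z≼top₂ (Z⋖top₀ ◅ top₀≼top₂) = ¬top≼top (λ ()) top₀≼top₂
¬Z≼top₂ (Z⋖top₁ ◅ top₁≼top₂) = ¬top≼top (λ ()) top₁≼top₂

X≼top⇒≤ : ∀ {n i} → X n ≼ top i → i ≤ 2 + n
Y≼top⇒≤ : ∀ {n i} → Y n ≼ top i → i ≤ 2 + n

X≼top⇒≤ (X₀⋖Z ◅ Z⋖top₀ ◅ ε) = z≤n
X≼top⇒≤ (X₀⋖Z ◅ Z⋖top₁ ◅ ε) = s≤s z≤n
X≼top⇒≤ (X₀⋖top₂ ◅ ε) = s≤s (s≤s z≤n)
X≼top⇒≤ (X⋖top ◅ ε) = ≤-refl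
X≼top⇒≤ (X⋖X ◅ p) = m≤n⇒m≤1+n (X≼top⇒≤ p)
X≼top⇒≤ (X⋖Y ◅ p) = m≤n⇒m≤1+n (Y≼top⇒≤ p)
X≼top⇒≤ (X₀⋖Z ◅ Z⋖top₀ ◅ () ◅ _)
X≼top⇒≤ (X₀⋖Z ◅ Z⋖top₁ ◅ () ◅ _)
X≼top⇒≤ (X₀⋖top₂ ◅ () ◅ _)
X≼top⇒≤ (X⋖top ◅ () ◅ _)

Y≼top⇒≤ (Y₀⋖top₀ ◅ ε) = z≤n
Y≼top⇒≤ (Y₀⋖top₁ ◅ ε) = s≤s z≤n
Y≼top⇒≤ (Y₀⋖top₂ ◅ ε) = s≤s (s≤s z≤n)
Y≼top⇒≤ (Y⋖top ◅ ε) = ≤-refl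
Y≼top⇒≤ (Y⋖X ◅ p) = m≤n⇒m≤1+n (X≼top⇒≤ p)
Y≼top⇒≤ (Y₀⋖top₀ ◅ () ◅ _)
Y≼top⇒≤ (Y₀⋖top₁ ◅ () ◅ _)
Y≼top⇒≤ (Y₀⋖top₂ ◅ () ◅ _)
Y≼top⇒≤ (Y⋖top ◅ () ◅ _)

X⋠top₃₊ : ∀ n → ¬ X n ≼ top (3 + n)
X⋠top₃₊ n = <-irrefl refl ∘ X≼top⇒≤

Y⋠top₃₊ : ∀ n → ¬ Y n ≼ top (3 + n)
Y⋠top₃₊ n = <-irrefl refl ∘ Y≼top⇒≤

≤⇒X≼top : ∀ {n i} → i ≤ 2 + n → X n ≼ top i
≤⇒X≼top {zero} {0} _ = X₀⋖Z ◅ Z⋖top₀ ◅ ε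
≤⇒X≼top {zero} {1} _ = X₀⋖Z ◅ Z⋖top₁ ◅ ε
≤⇒X≼top {zero} {2} _ = X₀⋖top₂ ◅ ε
≤⇒X≼top {zero} {suc (suc (suc _))} (s≤s (s≤s ()))
≤⇒X≼top {suc n} i≤3+n with m≤n⇒m<n∨m≡n i≤3+n
... | inj₁ (s≤s i≤2+n) = X⋖X ◅ ≤⇒X≼top i≤2+n
... | inj₂ refl = X⋖top ◅ ε

≤⇒Y≼top : ∀ {n i} → i ≤ 2 + n → Y n ≼ top i
≤⇒Y≼top {zero} {0} _ = Y₀⋖top₀ ◅ ε
≤⇒Y≼top {zero} {1} _ = Y₀⋖top₁ ◅ ε
≤⇒Y≼top {zero} {2} _ = Y₀⋖top₂ ◅ ε
≤⇒Y≼top {zero} {suc (suc (suc _))} (s≤s (s≤s ()))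
≤⇒Y≼top {suc n} i≤3+n with m≤n⇒m<n∨m≡n i≤3+n
... | inj₁ (s≤s i≤2+n) = Y⋖X ◅ ≤⇒X≼top i≤2+n
... | inj₂ refl = Y⋖top ◅ ε

≼top : ∀ p → ∃[ i ] p ≼ top i
≼top (top i) = i , ε
≼top Z = 0 , Z⋖top₀ ◅ ε
≼top (X n) = 0 , ≤⇒X≼top z≤n
≼top (Y n) = 0 , ≤⇒Y≼top z≤n

compact : Compact
compact p = let (i , p≼top) = ≼top p in top i , top-maximal i , p≼top

maximal⇒top : ∀ {m} → Maximal m → ∃[ i ] m ≡ top i
maximal⇒top {m} max = let (i , m≼top) = ≼top m in i , top-≼ (proj₂ (max (top i) m≼top))

Sim₀⇒≼top : ∀ {u v i} → Sim 0 u v → u ≼ top i → v ≼ top i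
Sim₀⇒≼top {i = i} sim = proj₁ (sim (top i) (top-maximal i))

Sim₀-X-Y : ∀ n → Sim 0 (X n) (Y n)
Sim₀-X-Y n m max with maximal⇒top max
... | _ , refl = ≤⇒Y≼top ∘ X≼top⇒≤ , ≤⇒X≼top ∘ Y≼top⇒≤

Y-above : ∀ {n w} → Y n ≼ w → w ≡ Y n ⊎ X n ≼ w
Y-above ε = inj₁ refl
Y-above (Y₀⋖top₀ ◅ p) = inj₂ (X₀⋖Z ◅ Z⋖top₀ ◅ p)
Y-above (Y₀⋖top₁ ◅ p) = inj₂ (X₀⋖Z ◅ Z⋖top₁ ◅ p)
Y-above (Y₀⋖top₂ ◅ p) = inj₂ (X₀⋖top₂ ◅ p)
Y-above (Y⋖top ◅ p) = inj₂ (X⋖top ◅ p)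
Y-above (Y⋖X ◅ p) = inj₂ (X⋖X ◅ p)

X-suc-above : ∀ {n w} → X (suc n) ≼ w → w ≡ X (suc n) ⊎ w ≡ Y n ⊎ Y (suc n) ≼ w
X-suc-above ε = inj₁ refl
X-suc-above (X⋖top ◅ p) = inj₂ (inj₂ (Y⋖top ◅ p))
X-suc-above (X⋖X ◅ p) = inj₂ (inj₂ (Y⋖X ◅ p))
X-suc-above (X⋖Y ◅ p) with Y-above p
... | inj₁ refl = inj₂ (inj₁ refl)
... | inj₂ q = inj₂ (inj₂ (Y⋖X ◅ q))

Sim-X-Y : ∀ n → Sim n (X n) (Y n)
Sim-X-Y zero = Sim₀-X-Y 0
Sim-X-Y (suc n) = below (suc n) ≤-refl
  where
  below : ∀ k → k ≤ suc n → Sim k (X (suc n)) (Y (suc n))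
  below zero _ = Sim₀-X-Y (suc n)
  below (suc k) (s≤s k≤n) = forth , back
    where
    forth : ∀ z → X (suc n) ≼ z → ∃[ w ] (Y (suc n) ≼ w × Sim k z w)
    forth z p with X-suc-above p
    ... | inj₁ refl = Y (suc n) , ε , below k (m≤n⇒m≤1+n k≤n)
    ... | inj₂ (inj₁ refl) = X n , Y⋖X ◅ ε , Sim-sym k (Sim-antitone k≤n (Sim-X-Y n))
    ... | inj₂ (inj₂ q) = z , q , Sim-refl k z
    back : ∀ w → Y (suc n) ≼ w → ∃[ z ] (X (suc n) ≼ z × Sim k z w)
    back w q with Y-above q
    ... | inj₁ refl = X (suc n) , ε , below k (m≤n⇒m≤1+n k≤n)
    ... | inj₂ p = w , p , Sim-refl k w

X-above : ∀ {n w} → X n ≼ w → w ≡ X n ⊎ ∃[ i ] (X n ≼ top i × ¬ w ≼ top i)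
X-above ε = inj₁ refl
X-above (X₀⋖Z ◅ ε) = inj₂ (2 , X₀⋖top₂ ◅ ε , ¬Z≼top₂)
X-above (X₀⋖Z ◅ Z⋖top₀ ◅ ε) = inj₂ (1 , X₀⋖Z ◅ Z⋖top₁ ◅ ε , ¬top≼top (λ ()))
X-above (X₀⋖Z ◅ Z⋖top₁ ◅ ε) = inj₂ (0 , X₀⋖Z ◅ Z⋖top₀ ◅ ε , ¬top≼top (λ ()))
X-above (X₀⋖top₂ ◅ ε) = inj₂ (0 , X₀⋖Z ◅ Z⋖top₀ ◅ ε , ¬top≼top (λ ()))
X-above (X⋖top ◅ ε) = inj₂ (0 , ≤⇒X≼top z≤n , ¬top≼top (λ ()))
X-above {suc n} (X⋖X ◅ p) = inj₂ (3 + n , X⋖top ◅ ε , X⋠top₃₊ n ∘ (p ◅◅_))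
X-above {suc n} (X⋖Y ◅ p) = inj₂ (3 + n , X⋖top ◅ ε , Y⋠top₃₊ n ∘ (p ◅◅_))
X-above (X₀⋖Z ◅ Z⋖top₀ ◅ () ◅ _)
X-above (X₀⋖Z ◅ Z⋖top₁ ◅ () ◅ _)
X-above (X₀⋖top₂ ◅ () ◅ _)
X-above (X⋖top ◅ () ◅ _)

Y-suc-above : ∀ {n w} → Y (suc n) ≼ w → w ≼ top (3 + n) ⊎ X n ≼ w
Y-suc-above ε = inj₁ (Y⋖top ◅ ε)
Y-suc-above (Y⋖top ◅ ε) = inj₁ ε
Y-suc-above (Y⋖X ◅ p) = inj₂ p
Y-suc-above (Y⋖top ◅ () ◅ _)

Z-unmatched : ∀ {w} → Y 0 ≼ w → ¬ Sim 0 Z w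
Z-unmatched ε sim = ¬Z≼top₂ (Sim₀⇒≼top (Sim-sym 0 sim) (Y₀⋖top₂ ◅ ε))
Z-unmatched (Y₀⋖top₀ ◅ ε) sim = ¬top≼top (λ ()) (Sim₀⇒≼top sim (Z⋖top₁ ◅ ε))
Z-unmatched (Y₀⋖top₁ ◅ ε) sim = ¬top≼top (λ ()) (Sim₀⇒≼top sim (Z⋖top₀ ◅ ε))
Z-unmatched (Y₀⋖top₂ ◅ ε) sim = ¬top≼top (λ ()) (Sim₀⇒≼top sim (Z⋖top₀ ◅ ε))
Z-unmatched (Y₀⋖top₀ ◅ () ◅ _)
Z-unmatched (Y₀⋖top₁ ◅ () ◅ _)
Z-unmatched (Y₀⋖top₂ ◅ () ◅ _)

Y-suc-above-Sim₀⇒≡X : ∀ {n w} → Y (suc n) ≼ w → Sim 0 (Y n) w → w ≡ X n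
Y-suc-above-Sim₀⇒≡X {n} Y≼w sim with Y-suc-above Y≼w
... | inj₁ w≼top = ⊥-elim (Y⋠top₃₊ n (Sim₀⇒≼top (Sim-sym 0 sim) w≼top))
... | inj₂ X≼w with X-above X≼w
...   | inj₁ w≡X = w≡X
...   | inj₂ (i , X≼top , w⋠top) = ⊥-elim (w⋠top (Sim₀⇒≼top sim (Sim₀⇒≼top (Sim₀-X-Y n) X≼top)))

¬Sim-X-Y : ∀ n → ¬ Sim (suc n) (X n) (Y n)
¬Sim-X-Y zero (forth , _) = let (w , Y₀≼w , sim) = forth Z (X₀⋖Z ◅ ε) in Z-unmatched Y₀≼w sim
¬Sim-X-Y (suc n) (forth , _) with forth (Y n) (X⋖Y ◅ ε)
... | w , Y≼w , sim with Y-suc-above-Sim₀⇒≡X Y≼w (Sim-antitone z≤n sim)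
...   | refl = ¬Sim-X-Y n (Sim-sym (suc n) sim)

proposition3p20 : Σ (Poset 0ℓ 0ℓ 0ℓ) (λ P → PosetNotions.Compact P × ((m n : ℕ) → m ≢ n → ¬ PosetNotions.SameQuotient P m n))
proposition3p20 = 𝔉 , compact , separated⇒distinct (λ n → X n , Y n , Sim-X-Y n , ¬Sim-X-Y n)
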